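{- Let $G=P_p\,\square\,P_q$ be a grid and $T\subseteq V(G)$ with $|E(G)|+|T|$ even. If there exists $U\in\{X_0,X_{q-1},Y_0,Y_{p-1}\}$ such that $(G[U],T\cap U)$ is not a bad path instance, then $G$ admits an acyclic $T$-odd orientation.
   Context: Graphs are finite and simple. An orientation is $T$-odd if every vertex $v$ has odd in-degree iff $v\in T$; acyclic means no directed cycle. $P_p$ is the path $u_0\cdots u_{p-1}$, $P_q$ the path $v_0\cdots v_{q-1}$; $P_p\square P_q$ has vertices $(u_i,v_j)$, adjacent iff equal in one coordinate and adjacent in the other path. $X_j=\{(u_i,v_j):0\le i\le p-1\}$ induces a path ordered by $i$; $Y_i=\{(u_i,v_j):0\le j\le q-1\}$ induces a path ordered by $j$. A bad path instance is a pair $(H,T')$ with $H$ a path $w_0\cdots w_{h-1}$, $h$ even, $w_0,w_{h-1}\in T'$, and for each $k\in\{1,\dots,(h-2)/2\}$, $w_{2k-1}\in T'$ iff $w_{2k}\in T'$. -}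

module Defs where

open import Data.Nat using (ℕ; zero; suc; _+_; _*_; _∸_; _≤_; _<_; _%_; _/_)
open import Data.Bool using (Bool; true; false; not; if_then_else_)
open import Data.Product using (_×_; _,_; proj₁; proj₂; ∃-syntax)
open import Data.Sum using (_⊎_)
open import Data.List using (List; map; upTo; cartesianProduct)
open import Data.Nat.ListAction using (sum)
open import Relation.Binary.PropositionalEquality using (_≡_)
open import Relation.Nullary using (¬_)

-- Vertices of P_p □ P_q: (i , j) stands for (u_i , v_j), with i < p and j < q.
Vertex : Set
Vertex = ℕ × ℕ

InGrid : ℕ → ℕ → Vertex → Set
InGrid p q (i , j) = (i < p) × (j < q)

vertices : ℕ → ℕ → List Vertex
vertices p q = cartesianProduct (upTo p) (upTo q)

Adj : ℕ → ℕ → Vertex → Vertex → Set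
Adj p q (i , j) (i' , j') =
  InGrid p q (i , j) × InGrid p q (i' , j') ×
  (((i ≡ i') × ((suc j ≡ j') ⊎ (suc j' ≡ j))) ⊎
   ((j ≡ j') × ((suc i ≡ i') ⊎ (suc i' ≡ i))))

numEdges : ℕ → ℕ → ℕ
numEdges p q = (p ∸ 1) * q + p * (q ∸ 1)

-- A subset T ⊆ V(G) is given by its (Boolean) indicator; only grid vertices matter.
Subset : Set
Subset = Vertex → Bool

indicator : Bool → ℕ
indicator b = if b then 1 else 0

card : ℕ → ℕ → Subset → ℕ
card p q T = sum (map (λ x → indicator (T x)) (vertices p q))

-- An orientation of G: D x y ≡ true means the edge xy is directed x → y.
-- Every edge gets exactly one direction, and only edges are directed.
IsOrientation : ℕ → ℕ → (Vertex → Vertex → Bool) → Set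
IsOrientation p q D =
  (∀ x y → Adj p q x y → D x y ≡ not (D y x)) ×
  (∀ x y → D x y ≡ true → Adj p q x y)

inDegree : ℕ → ℕ → (Vertex → Vertex → Bool) → Vertex → ℕ
inDegree p q D v = sum (map (λ x → indicator (D x v)) (vertices p q))

IsTOdd : ℕ → ℕ → Subset → (Vertex → Vertex → Bool) → Set
IsTOdd p q T D = ∀ v → InGrid p q v →
  ((inDegree p q D v % 2 ≡ 1) → T v ≡ true) × (T v ≡ true → inDegree p q D v % 2 ≡ 1)

data DWalk (D : Vertex → Vertex → Bool) : Vertex → Vertex → Set where
  step : ∀ {x y} → D x y ≡ true → DWalk D x y
  cons : ∀ {x y z} → D x y ≡ true → DWalk D y z → DWalk D x z

IsAcyclic : (Vertex → Vertex → Bool) → Set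
IsAcyclic D = ∀ x → ¬ DWalk D x x

-- Bad path instance (H , T') with H = w_0 ⋯ w_{h-1}; t k ≡ true iff w_k ∈ T'
-- (values of t at k ≥ h are irrelevant).
BadPath : (h : ℕ) → (t : ℕ → Bool) → Set
BadPath h t =
  (h % 2 ≡ 0) × (1 ≤ h) × (t 0 ≡ true) × (t (h ∸ 1) ≡ true) ×
  (∀ k → 1 ≤ k → k ≤ (h ∸ 2) / 2 → (t (2 * k ∸ 1) ≡ true → t (2 * k) ≡ true) × (t (2 * k) ≡ true → t (2 * k ∸ 1) ≡ true))

-- (G[X_j], T ∩ X_j): path ordered by i.   (G[Y_i], T ∩ Y_i): path ordered by j.
rowX : Subset → ℕ → ℕ → Bool
rowX T j i = T (i , j)

colY : Subset → ℕ → ℕ → Bool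
colY T i j = T (i , j)

-- An acyclic orientation is one along which some ranking of the vertices, injective on edges,
-- increases, and the in-degree of a vertex of P_p □ P_q is then the sum of its in-degrees in
-- its row and in its column. Any in-degree parities on a path with the right total are
-- realised by a height function. If p is odd, rank the rows by a height function of the row
-- index and each row by its own height function: the vertical edges give all vertices of a row
-- the same parity, which (the row having odd length) can be chosen as the parity that row
-- requires, and the handshake condition makes the heights of the rows possible; q odd is the
-- transpose. If p and q are even, a boundary side that is not a bad path instance can be cut
-- into two odd segments one of which meets T evenly; cutting off that side and cutting at
-- that point splits the grid into four blocks of odd dimensions, not all meeting T oddly. The
-- blocks form a 4-cycle, which then has an acyclic orientation with the in-degree parities the
-- blocks need; ranking first by it and then inside each block as in the odd case finishes.

{-# OPTIONS --safe #-}
module Submission where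

open import Defs

open import Data.Bool using (Bool; true; false; not; _∧_; _∨_; _xor_; T; if_then_else_)
import Data.Bool as Bool
open import Data.Bool.Properties
  using ( ¬-not; not-involutive; not-distribˡ-xor; not-distribʳ-xor; xor-assoc; xor-comm; xor-same
        ; xor-identityʳ; ∧-zeroʳ; ∧-identityʳ; ∧-comm; ∧-distribˡ-xor; ∧-distribʳ-xor )
open import Data.Bool.Solver using (module xor-∧-Solver)
open import Data.Empty using (⊥-elim)
open import Data.Integer using (ℤ; 0ℤ) renaming (suc to sucℤ; pred to predℤ)
import Data.Integer.Properties as ℤ
open import Data.List using (map; _++_; applyUpTo; upTo; cartesianProduct)
open import Data.List.Properties using (map-++; map-applyUpTo)
open import Data.Nat using (ℕ; zero; suc; _+_; _*_; _∸_; _≤_; _<_; _%_; _≡ᵇ_; _<ᵇ_; _≤ᵇ_; z≤n; s≤s)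
open import Data.Nat.DivMod using (_/_; m/n*n≤m)
open import Data.Nat.ListAction using (sum)
open import Data.Nat.ListAction.Properties using (sum-++)
open import Data.Nat.Properties
  using ( _<?_; _≤?_; _≟_; ≡ᵇ⇒≡; <ᵇ⇒<; anyUpTo?; +-identityʳ; +-comm; +-suc; *-comm; *-monoʳ-≤
        ; ≤-refl; ≤-trans; <-trans; <-irrefl; n<1+n; <⇒≤; <⇒≱; <⇒≢; ≮⇒≥; m≤n⇒m<n∨m≡n; m≤m+n
        ; m+n∸m≡n; m+n∸n≡m; m+[n∸m]≡n; n∸n≡0; ∸-monoˡ-< )
import Data.Nat.Properties as ℕ
open import Data.Product using (_×_; _,_; proj₁; proj₂; ∃-syntax)
open import Data.Product.Relation.Binary.Lex.Strict using (×-Lex; ×-strictTotalOrder)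
open import Data.Sum using (_⊎_; inj₁; inj₂)
open import Data.Unit using (tt)
open import Function using (_∘_; id)
open import Function.Bundles using (mk⇔)
open import Level using (_⊔_)
open import Relation.Binary.Bundles using (StrictTotalOrder)
open import Relation.Binary.Definitions using (Tri; tri<; tri≈; tri>)
open import Relation.Binary.PropositionalEquality
  using (_≡_; _≢_; refl; sym; trans; cong; cong₂; subst; module ≡-Reasoning)
open import Relation.Nullary using (¬_; Dec; yes; no; does; _×-dec_; _⊎-dec_)
open import Relation.Nullary.Decidable using (dec-true; dec-false; does-⇔)

open xor-∧-Solver using (solve; _:=_; _:+_; _:*_)

≡ᵇ-sym : ∀ m n → (m ≡ᵇ n) ≡ (n ≡ᵇ m)
≡ᵇ-sym zero zero = refl
≡ᵇ-sym zero (suc n) = refl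
≡ᵇ-sym (suc m) zero = refl
≡ᵇ-sym (suc m) (suc n) = ≡ᵇ-sym m n

≡ᵇ-refl : ∀ n → (n ≡ᵇ n) ≡ true
≡ᵇ-refl zero = refl
≡ᵇ-refl (suc n) = ≡ᵇ-refl n

1+n≡ᵇn : ∀ n → (suc n ≡ᵇ n) ≡ false
1+n≡ᵇn zero = refl
1+n≡ᵇn (suc n) = 1+n≡ᵇn n

2+n≡ᵇn : ∀ n → (suc (suc n) ≡ᵇ n) ≡ false
2+n≡ᵇn zero = refl
2+n≡ᵇn (suc n) = 2+n≡ᵇn n

≡ᵇ⇒≡′ : ∀ {m n} → (m ≡ᵇ n) ≡ true → m ≡ n
≡ᵇ⇒≡′ {m} {n} e = ≡ᵇ⇒≡ m n (subst T (sym e) tt)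

<⇒<ᵇ′ : ∀ {m n} → m < n → (m <ᵇ n) ≡ true
<⇒<ᵇ′ {m} {n} m<n = dec-true (m <? n) m<n

<ᵇ⇒<′ : ∀ {m n} → (m <ᵇ n) ≡ true → m < n
<ᵇ⇒<′ {m} {n} e = <ᵇ⇒< m n (subst T (sym e) tt)

n<ᵇn : ∀ n → (n <ᵇ n) ≡ false
n<ᵇn n = dec-false (n <? n) (<-irrefl refl)

+-<ᵇ-∸ : ∀ c m n → (c + m <ᵇ n) ≡ (m <ᵇ n ∸ c)
+-<ᵇ-∸ zero m n = refl
+-<ᵇ-∸ (suc c) m zero = refl
+-<ᵇ-∸ (suc c) m (suc n) = +-<ᵇ-∸ c m n

∧-congˡ-if : ∀ c {x y} → (c ≡ true → x ≡ y) → c ∧ x ≡ c ∧ y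
∧-congˡ-if false _ = refl
∧-congˡ-if true x≡y = x≡y refl

∧-true : ∀ {x y} → x ∧ y ≡ true → (x ≡ true) × (y ≡ true)
∧-true {true} {true} _ = refl , refl

xor-false : ∀ x y → x xor y ≡ false → y ≡ x
xor-false true true _ = refl
xor-false false false _ = refl

xor-true : ∀ x y → x xor y ≡ true → y ≡ not x
xor-true true false _ = refl
xor-true false true _ = refl

∨⇒xor : ∀ x y → x ∧ y ≡ false → x ∨ y ≡ x xor y
∨⇒xor true true ()
∨⇒xor true false _ = refl
∨⇒xor false y _ = refl

does-true⇒ : ∀ {a} {A : Set a} (a? : Dec A) → does a? ≡ true → A
does-true⇒ (yes a) _ = a

-- Parity

odd : ℕ → Bool
odd zero = false
odd (suc n) = not (odd n)

n%2≡indicator[odd] : ∀ n → n % 2 ≡ indicator (odd n)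
n%2≡indicator[odd] zero = refl
n%2≡indicator[odd] (suc zero) = refl
n%2≡indicator[odd] (suc (suc n)) = trans (n%2≡indicator[odd] n) (cong indicator (sym (not-involutive (odd n))))

odd-+ : ∀ m n → odd (m + n) ≡ odd m xor odd n
odd-+ zero n = refl
odd-+ (suc m) n = trans (cong not (odd-+ m n)) (not-distribˡ-xor (odd m) (odd n))

odd-* : ∀ m n → odd (m * n) ≡ odd m ∧ odd n
odd-* zero n = refl
odd-* (suc m) n = begin
  odd (n + m * n)            ≡⟨ odd-+ n (m * n) ⟩
  odd n xor odd (m * n)      ≡⟨ cong (odd n xor_) (odd-* m n) ⟩
  odd n xor (odd m ∧ odd n)  ≡⟨ absorb (odd m) (odd n) ⟩
  not (odd m) ∧ odd n        ∎
  where
  open ≡-Reasoning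
  absorb : ∀ a b → b xor (a ∧ b) ≡ not a ∧ b
  absorb true b = xor-same b
  absorb false b = xor-identityʳ b

odd-∸ : ∀ {m n} → n ≤ m → odd (m ∸ n) ≡ odd m xor odd n
odd-∸ {m} {n} n≤m = begin
  odd (m ∸ n)                       ≡⟨ sym (xor-cancelˡ (odd n) _) ⟩
  odd n xor (odd n xor odd (m ∸ n)) ≡⟨ cong (odd n xor_) (sym (odd-+ n (m ∸ n))) ⟩
  odd n xor odd (n + (m ∸ n))       ≡⟨ cong (λ x → odd n xor odd x) (m+[n∸m]≡n n≤m) ⟩
  odd n xor odd m                   ≡⟨ xor-comm (odd n) (odd m) ⟩
  odd m xor odd n                   ∎
  where
  open ≡-Reasoning
  xor-cancelˡ : ∀ x y → x xor (x xor y) ≡ y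
  xor-cancelˡ = solve 2 (λ x y → x :+ (x :+ y) := y) refl

odd⇒positive : ∀ {n} → odd n ≡ true → 0 < n
odd⇒positive {suc n} _ = s≤s z≤n

xorUpTo : (ℕ → Bool) → ℕ → Bool
xorUpTo f zero = false
xorUpTo f (suc n) = f 0 xor xorUpTo (f ∘ suc) n

xorUpTo-cong : ∀ {f g} n → (∀ k → k < n → f k ≡ g k) → xorUpTo f n ≡ xorUpTo g n
xorUpTo-cong zero f≗g = refl
xorUpTo-cong (suc n) f≗g = cong₂ _xor_ (f≗g 0 (s≤s z≤n)) (xorUpTo-cong n (λ k k<n → f≗g (suc k) (s≤s k<n)))

xorUpTo-xor : ∀ (f g : ℕ → Bool) n → xorUpTo (λ k → f k xor g k) n ≡ xorUpTo f n xor xorUpTo g n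
xorUpTo-xor f g zero = refl
xorUpTo-xor f g (suc n) = trans (cong ((f 0 xor g 0) xor_) (xorUpTo-xor (f ∘ suc) (g ∘ suc) n))
  (interchange (f 0) (g 0) (xorUpTo (f ∘ suc) n) (xorUpTo (g ∘ suc) n))
  where
  interchange : ∀ a b c d → (a xor b) xor (c xor d) ≡ (a xor c) xor (b xor d)
  interchange = solve 4 (λ a b c d → (a :+ b) :+ (c :+ d) := (a :+ c) :+ (b :+ d)) refl

xorUpTo-∧ˡ : ∀ b (f : ℕ → Bool) n → xorUpTo (λ k → b ∧ f k) n ≡ b ∧ xorUpTo f n
xorUpTo-∧ˡ b f zero = sym (∧-zeroʳ b)
xorUpTo-∧ˡ b f (suc n) = trans (cong ((b ∧ f 0) xor_) (xorUpTo-∧ˡ b (f ∘ suc) n))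
  (sym (∧-distribˡ-xor b (f 0) (xorUpTo (f ∘ suc) n)))

xorUpTo-∧ʳ : ∀ (f : ℕ → Bool) b n → xorUpTo (λ k → f k ∧ b) n ≡ xorUpTo f n ∧ b
xorUpTo-∧ʳ f b n = trans (xorUpTo-cong n (λ k _ → ∧-comm (f k) b))
  (trans (xorUpTo-∧ˡ b f n) (∧-comm b (xorUpTo f n)))

xorUpTo-const : ∀ b n → xorUpTo (λ _ → b) n ≡ b ∧ odd n
xorUpTo-const b zero = sym (∧-zeroʳ b)
xorUpTo-const true (suc n) = cong not (xorUpTo-const true n)
xorUpTo-const false (suc n) = xorUpTo-const false n

xorUpTo-false : ∀ n → xorUpTo (λ _ → false) n ≡ false
xorUpTo-false n = xorUpTo-const false n

xorUpTo-delta : ∀ u (g : ℕ → Bool) n → xorUpTo (λ k → (k ≡ᵇ u) ∧ g k) n ≡ (u <ᵇ n) ∧ g u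
xorUpTo-delta u g zero = refl
xorUpTo-delta zero g (suc n) = trans (cong (g 0 xor_) (xorUpTo-false n)) (xor-identityʳ (g 0))
xorUpTo-delta (suc u) g (suc n) = xorUpTo-delta u (g ∘ suc) n

xorUpTo-+ : ∀ (f : ℕ → Bool) m n → xorUpTo f (m + n) ≡ xorUpTo f m xor xorUpTo (λ k → f (m + k)) n
xorUpTo-+ f zero n = refl
xorUpTo-+ f (suc m) n = trans (cong (f 0 xor_) (xorUpTo-+ (f ∘ suc) m n))
  (sym (xor-assoc (f 0) (xorUpTo (f ∘ suc) m) _))

xorUpTo-suc : ∀ (f : ℕ → Bool) n → xorUpTo f (suc n) ≡ xorUpTo f n xor f n
xorUpTo-suc f n = begin
  xorUpTo f (suc n)                        ≡⟨ cong (xorUpTo f) (+-comm 1 n) ⟩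
  xorUpTo f (n + 1)                        ≡⟨ xorUpTo-+ f n 1 ⟩
  xorUpTo f n xor (f (n + 0) xor false)
    ≡⟨ cong (λ x → xorUpTo f n xor x) (trans (xor-identityʳ _) (cong f (+-identityʳ n))) ⟩
  xorUpTo f n xor f n                      ∎
  where open ≡-Reasoning

xorUpTo-swap : ∀ (f : ℕ → ℕ → Bool) m n →
  xorUpTo (λ i → xorUpTo (f i) n) m ≡ xorUpTo (λ j → xorUpTo (λ i → f i j) m) n
xorUpTo-swap f zero n = sym (xorUpTo-false n)
xorUpTo-swap f (suc m) n = trans (cong (xorUpTo (f 0) n xor_) (xorUpTo-swap (f ∘ suc) m n))
  (sym (xorUpTo-xor (f 0) (λ j → xorUpTo (λ i → f (suc i) j) m) n))

gridParity : Subset → ℕ → ℕ → Bool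
gridParity T p q = xorUpTo (λ i → xorUpTo (λ j → T (i , j)) q) p

gridParity-separable : ∀ (f g : ℕ → Bool) m n →
  gridParity (λ (i , j) → f i xor g j) m n ≡ (xorUpTo f m ∧ odd n) xor (odd m ∧ xorUpTo g n)
gridParity-separable f g m n = begin
  xorUpTo (λ i → xorUpTo (λ j → f i xor g j) n) m
    ≡⟨ xorUpTo-cong m (λ i _ → trans (xorUpTo-xor (λ _ → f i) g n) (cong (_xor xorUpTo g n) (xorUpTo-const (f i) n))) ⟩
  xorUpTo (λ i → (f i ∧ odd n) xor xorUpTo g n) m
    ≡⟨ xorUpTo-xor (λ i → f i ∧ odd n) (λ _ → xorUpTo g n) m ⟩
  xorUpTo (λ i → f i ∧ odd n) m xor xorUpTo (λ _ → xorUpTo g n) m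
    ≡⟨ cong₂ _xor_ (xorUpTo-∧ʳ f (odd n) m) (trans (xorUpTo-const (xorUpTo g n) m) (∧-comm (xorUpTo g n) (odd m))) ⟩
  (xorUpTo f m ∧ odd n) xor (odd m ∧ xorUpTo g n) ∎
  where open ≡-Reasoning

gridParity-xor : ∀ (f g : Subset) m n → gridParity (λ x → f x xor g x) m n ≡ gridParity f m n xor gridParity g m n
gridParity-xor f g m n = trans (xorUpTo-cong m (λ i _ → xorUpTo-xor _ _ n)) (xorUpTo-xor _ _ m)

swap : Vertex → Vertex
swap (i , j) = (j , i)

gridParity-swap : ∀ T p q → gridParity (T ∘ swap) q p ≡ gridParity T p q
gridParity-swap T p q = sym (xorUpTo-swap (λ i j → T (i , j)) p q)

odd-indicator : ∀ b → odd (indicator b) ≡ b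
odd-indicator true = refl
odd-indicator false = refl

odd-sum-++ : ∀ ms ns → odd (sum (ms ++ ns)) ≡ odd (sum ms) xor odd (sum ns)
odd-sum-++ ms ns = trans (cong odd (sum-++ ms ns)) (odd-+ (sum ms) (sum ns))

odd-count-applyUpTo : ∀ (f : ℕ → Bool) n → odd (sum (applyUpTo (indicator ∘ f) n)) ≡ xorUpTo f n
odd-count-applyUpTo f zero = refl
odd-count-applyUpTo f (suc n) = trans (odd-+ (indicator (f 0)) _)
  (cong₂ _xor_ (odd-indicator (f 0)) (odd-count-applyUpTo (f ∘ suc) n))

odd-count-product : ∀ (f : Vertex → Bool) (g : ℕ → ℕ) n q →
  odd (sum (map (indicator ∘ f) (cartesianProduct (applyUpTo g n) (upTo q)))) ≡
  xorUpTo (λ i → xorUpTo (λ j → f (g i , j)) q) n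
odd-count-product f g zero q = refl
odd-count-product f g (suc n) q = begin
  odd (sum (map (indicator ∘ f) (row ++ rest)))
    ≡⟨ cong (odd ∘ sum) (map-++ (indicator ∘ f) row rest) ⟩
  odd (sum (map (indicator ∘ f) row ++ map (indicator ∘ f) rest))
    ≡⟨ odd-sum-++ (map (indicator ∘ f) row) _ ⟩
  odd (sum (map (indicator ∘ f) row)) xor odd (sum (map (indicator ∘ f) rest))
    ≡⟨ cong₂ _xor_ rowParity (odd-count-product f (g ∘ suc) n q) ⟩
  xorUpTo (λ j → f (g 0 , j)) q xor xorUpTo (λ i → xorUpTo (λ j → f (g (suc i) , j)) q) n ∎
  where
  open ≡-Reasoning
  row = map (g 0 ,_) (upTo q)
  rest = cartesianProduct (applyUpTo (g ∘ suc) n) (upTo q)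
  rowParity : odd (sum (map (indicator ∘ f) row)) ≡ xorUpTo (λ j → f (g 0 , j)) q
  rowParity = trans (cong (λ xs → odd (sum (map (indicator ∘ f) xs))) (map-applyUpTo (λ j → j) (g 0 ,_) q))
    (trans (cong (odd ∘ sum) (map-applyUpTo (g 0 ,_) (indicator ∘ f) q))
      (odd-count-applyUpTo (λ j → f (g 0 , j)) q))

odd-count-vertices : ∀ (f : Vertex → Bool) p q →
  odd (sum (map (λ x → indicator (f x)) (vertices p q))) ≡ gridParity f p q
odd-count-vertices f p q = odd-count-product f (λ i → i) p q

odd-numEdges : ∀ p q → 1 ≤ p → 1 ≤ q → odd (numEdges p q) ≡ odd p xor odd q
odd-numEdges (suc p) (suc q) _ _ = begin
  odd (p * suc q + suc p * q)                    ≡⟨ odd-+ (p * suc q) (suc p * q) ⟩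
  odd (p * suc q) xor odd (suc p * q)            ≡⟨ cong₂ _xor_ (odd-* p (suc q)) (odd-* (suc p) q) ⟩
  (odd p ∧ not (odd q)) xor (not (odd p) ∧ odd q) ≡⟨ opposite (odd p) (odd q) ⟩
  not (odd p) xor not (odd q)                    ∎
  where
  open ≡-Reasoning
  opposite : ∀ a b → (a ∧ not b) xor (not a ∧ b) ≡ not a xor not b
  opposite true true = refl
  opposite true false = refl
  opposite false true = refl
  opposite false false = refl

gridParity-from-handshake : ∀ p q T → 1 ≤ p → 1 ≤ q → (numEdges p q + card p q T) % 2 ≡ 0 →
  gridParity T p q ≡ odd p xor odd q
gridParity-from-handshake p q T 1≤p 1≤q even = begin
  gridParity T p q                          ≡⟨ sym (odd-count-vertices T p q) ⟩
  odd (card p q T)                          ≡⟨ xor-cancel (odd (numEdges p q)) (odd (card p q T)) sumEven ⟩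
  odd (numEdges p q)                        ≡⟨ odd-numEdges p q 1≤p 1≤q ⟩
  odd p xor odd q                           ∎
  where
  open ≡-Reasoning
  sumEven : odd (numEdges p q) xor odd (card p q T) ≡ false
  sumEven = trans (sym (odd-+ (numEdges p q) (card p q T)))
    (indicator-0 (trans (sym (n%2≡indicator[odd] (numEdges p q + card p q T))) even))
    where
    indicator-0 : ∀ {b} → indicator b ≡ 0 → b ≡ false
    indicator-0 {false} _ = refl
  xor-cancel : ∀ a b → a xor b ≡ false → b ≡ a
  xor-cancel true true _ = refl
  xor-cancel false false _ = refl

-- In-degrees on a path

-- Neighbours k, j on the path 0 ⋯ n-1, in the shape the definition of Adj produces.
pathAdj : ℕ → ℕ → Bool
pathAdj k j = (suc k ≡ᵇ j) ∨ (suc j ≡ᵇ k)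

pathAdj-irrefl : ∀ k j → (k ≡ᵇ j) ∧ pathAdj k j ≡ false
pathAdj-irrefl k j with k ≡ᵇ j in k≡j
... | false = refl
... | true with refl ← ≡ᵇ⇒≡′ {k} {j} k≡j rewrite 1+n≡ᵇn k = refl

module _ {a} {A : Set a} (_≺_ : A → A → Bool) where

  inFromLeft : (ℕ → A) → ℕ → Bool
  inFromLeft f zero = false
  inFromLeft f (suc k) = f k ≺ f (suc k)

  inFromRight : ℕ → (ℕ → A) → ℕ → Bool
  inFromRight n f k = (suc k <ᵇ n) ∧ (f (suc k) ≺ f k)

  -- Parity of the in-degree of k when the path 0 ⋯ n-1 is oriented along _≺_ on f.
  pathDeg : ℕ → (ℕ → A) → ℕ → Bool
  pathDeg n f k = inFromLeft f k xor inFromRight n f k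

  pathDeg-≗ : ∀ n {f g : ℕ → A} → (∀ i → f i ≡ g i) → ∀ k → pathDeg n f k ≡ pathDeg n g k
  pathDeg-≗ n {f} {g} f≗g zero = cong (λ x → (1 <ᵇ n) ∧ x) (cong₂ _≺_ (f≗g 1) (f≗g 0))
  pathDeg-≗ n {f} {g} f≗g (suc k) =
    cong₂ (λ x y → x xor ((suc (suc k) <ᵇ n) ∧ y))
      (cong₂ _≺_ (f≗g k) (f≗g (suc k))) (cong₂ _≺_ (f≗g (suc (suc k))) (f≗g (suc k)))

  xorUpTo-pathAdj : ∀ n (f : ℕ → A) j → j < n →
    xorUpTo (λ k → pathAdj k j ∧ (f k ≺ f j)) n ≡ pathDeg n f j
  xorUpTo-pathAdj n f j j<n = begin
    xorUpTo (λ k → pathAdj k j ∧ (f k ≺ f j)) n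
      ≡⟨ xorUpTo-cong n (λ k _ → split k) ⟩
    xorUpTo (λ k → ((suc k ≡ᵇ j) ∧ (f k ≺ f j)) xor ((k ≡ᵇ suc j) ∧ (f k ≺ f j))) n
      ≡⟨ xorUpTo-xor _ _ n ⟩
    xorUpTo (λ k → (suc k ≡ᵇ j) ∧ (f k ≺ f j)) n xor xorUpTo (λ k → (k ≡ᵇ suc j) ∧ (f k ≺ f j)) n
      ≡⟨ cong₂ _xor_ (fromLeft j j<n) (xorUpTo-delta (suc j) (λ k → f k ≺ f j) n) ⟩
    pathDeg n f j ∎
    where
    open ≡-Reasoning
    split : ∀ k → pathAdj k j ∧ (f k ≺ f j) ≡ ((suc k ≡ᵇ j) ∧ (f k ≺ f j)) xor ((k ≡ᵇ suc j) ∧ (f k ≺ f j))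
    split k = trans
      (cong (_∧ (f k ≺ f j)) (trans (∨⇒xor (suc k ≡ᵇ j) (suc j ≡ᵇ k) (exclusive k j))
                                    (cong ((suc k ≡ᵇ j) xor_) (≡ᵇ-sym (suc j) k))))
      (∧-distribʳ-xor (f k ≺ f j) (suc k ≡ᵇ j) (k ≡ᵇ suc j))
      where
      exclusive : ∀ k j → (suc k ≡ᵇ j) ∧ (suc j ≡ᵇ k) ≡ false
      exclusive k j with suc k ≡ᵇ j in e
      ... | false = refl
      ... | true with refl ← ≡ᵇ⇒≡′ {suc k} {j} e = 2+n≡ᵇn k
    fromLeft : ∀ j → j < n → xorUpTo (λ k → (suc k ≡ᵇ j) ∧ (f k ≺ f j)) n ≡ inFromLeft f j
    fromLeft zero _ = xorUpTo-false n
    fromLeft (suc j) 1+j<n = trans (xorUpTo-delta j (λ k → f k ≺ f (suc j)) n)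
      (cong (_∧ (f j ≺ f (suc j))) (<⇒<ᵇ′ (<-trans (n<1+n j) 1+j<n)))

module _ {a b} {A : Set a} {B : Set b} (_≺₁_ : A → A → Bool) (_≺₂_ : B → B → Bool) where

  OrderedAlike : ℕ → (ℕ → A) → (ℕ → B) → Set
  OrderedAlike n f g = ∀ k → suc k < n →
    ((f k ≺₁ f (suc k)) ≡ (g k ≺₂ g (suc k))) × ((f (suc k) ≺₁ f k) ≡ (g (suc k) ≺₂ g k))

  pathDeg-cong : ∀ n f g → OrderedAlike n f g → ∀ k → k < n → pathDeg _≺₁_ n f k ≡ pathDeg _≺₂_ n g k
  pathDeg-cong n f g alike k k<n =
    cong₂ _xor_ (fromLeft k k<n) (∧-congˡ-if (suc k <ᵇ n) (λ c → proj₂ (alike k (<ᵇ⇒<′ c))))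
    where
    fromLeft : ∀ k → k < n → inFromLeft _≺₁_ f k ≡ inFromLeft _≺₂_ g k
    fromLeft zero _ = refl
    fromLeft (suc k) 1+k<n = proj₁ (alike k 1+k<n)

-- The path 0 ⋯ n-1 cut before c: segment false is 0 ⋯ c-1 and segment true is c ⋯ n-1.
side : ℕ → ℕ → Bool
side c i = c ≤ᵇ i

offset : ℕ → Bool → ℕ
offset c false = 0
offset c true = c

segLength : ℕ → ℕ → Bool → ℕ
segLength n c false = c
segLength n c true = n ∸ c

local : ℕ → ℕ → ℕ
local c i = i ∸ offset c (side c i)

-- The local position k of segment h is the end of the cut edge.
atCut : ℕ → Bool → ℕ → Bool
atCut c false k = suc k ≡ᵇ c
atCut c true k = k ≡ᵇ 0

side-offset : ∀ {n c} h k → k < segLength n c h → side c (offset c h + k) ≡ h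
side-offset {c = c} false k k<c = dec-false (c ≤? k) (<⇒≱ k<c)
side-offset {c = c} true k _ = dec-true (c ≤? c + k) (m≤m+n c k)

local-offset : ∀ {n c} h k → k < segLength n c h → local c (offset c h + k) ≡ k
local-offset {n} {c} h k k< rewrite side-offset {n} h k k< = m+n∸m≡n (offset c h) k

xorUpTo-atCut : ∀ {n c} → 0 < c → c < n → ∀ h → xorUpTo (atCut c h) (segLength n c h) ≡ true
xorUpTo-atCut {n} {suc c} _ _ false = trans (xorUpTo-cong (suc c) (λ k _ → sym (∧-identityʳ (k ≡ᵇ c))))
  (trans (xorUpTo-delta c (λ _ → true) (suc c)) (cong (_∧ true) (<⇒<ᵇ′ (n<1+n c))))
xorUpTo-atCut {n} {c} _ c<n true with n ∸ c | ∸-monoˡ-< {c} {c} {n} c<n ≤-refl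
... | suc r | _ = cong not (xorUpTo-false r)

data Position (n c : ℕ) : ℕ → Set where
  position : ∀ h k → k < segLength n c h → Position n c (offset c h + k)

position-view : ∀ {n c i} → c ≤ n → i < n → Position n c i
position-view {n} {c} {i} c≤n i<n with i <? c
... | yes i<c = position false i i<c
... | no i≮c = subst (Position n c) (m+[n∸m]≡n c≤i) (position true (i ∸ c) (∸-monoˡ-< i<n c≤i))
  where c≤i = ≮⇒≥ i≮c

module _ {a} {A : Set a} (_≺_ : A → A → Bool) (f : ℕ → A) where

  pathDeg-prefix : ∀ {n c} i → c < n → i < c →
    pathDeg _≺_ n f i ≡ pathDeg _≺_ c f i xor ((suc i ≡ᵇ c) ∧ (f (suc i) ≺ f i))
  pathDeg-prefix {n} {c} i c<n i<c = trans
    (cong (λ b → inFromLeft _≺_ f i xor (b ∧ (f (suc i) ≺ f i))) split)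
    (regroup (inFromLeft _≺_ f i) (suc i <ᵇ c) (suc i ≡ᵇ c) (f (suc i) ≺ f i))
    where
    split : (suc i <ᵇ n) ≡ (suc i <ᵇ c) xor (suc i ≡ᵇ c)
    split with m≤n⇒m<n∨m≡n i<c
    ... | inj₁ 1+i<c rewrite <⇒<ᵇ′ 1+i<c | <⇒<ᵇ′ (<-trans 1+i<c c<n)
                           | dec-false (suc i ≟ c) (<⇒≢ 1+i<c) = refl
    ... | inj₂ refl rewrite <⇒<ᵇ′ c<n | n<ᵇn (suc i) | ≡ᵇ-refl i = refl
    regroup : ∀ l x y e → l xor ((x xor y) ∧ e) ≡ (l xor (x ∧ e)) xor (y ∧ e)
    regroup = solve 4 (λ l x y e → l :+ ((x :+ y) :* e) := (l :+ (x :* e)) :+ (y :* e)) refl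

  pathDeg-suffix : ∀ {n c} k → 0 < c →
    pathDeg _≺_ n f (c + k) ≡ pathDeg _≺_ (n ∸ c) (λ k′ → f (c + k′)) k xor ((k ≡ᵇ 0) ∧ (f (c ∸ 1) ≺ f c))
  pathDeg-suffix {n} {c} k 0<c = trans (cong₂ _xor_ (fromLeft k 0<c) fromRight)
    (swap-last (inFromLeft _≺_ (λ k′ → f (c + k′)) k) _ (inFromRight _≺_ (n ∸ c) (λ k′ → f (c + k′)) k))
    where
    fromLeft : ∀ k → 0 < c →
      inFromLeft _≺_ f (c + k) ≡ inFromLeft _≺_ (λ k′ → f (c + k′)) k xor ((k ≡ᵇ 0) ∧ (f (c ∸ 1) ≺ f c))
    fromLeft zero (s≤s {n = c′} _) rewrite +-identityʳ c′ = refl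
    fromLeft (suc k) _ rewrite +-suc c k = sym (xor-identityʳ _)
    fromRight : inFromRight _≺_ n f (c + k) ≡ inFromRight _≺_ (n ∸ c) (λ k′ → f (c + k′)) k
    fromRight = cong₂ _∧_ (trans (cong (_<ᵇ n) (sym (+-suc c k))) (+-<ᵇ-∸ c (suc k) n))
                          (cong (λ x → f x ≺ f (c + k)) (sym (+-suc c k)))
    swap-last : ∀ l x r → (l xor x) xor r ≡ (l xor r) xor x
    swap-last = solve 3 (λ l x r → (l :+ x) :+ r := (l :+ r) :+ x) refl

-- In-degrees in the grid

adj? : ∀ p q x y → Dec (Adj p q x y)
adj? p q (i , j) (i′ , j′) =
  ((i <? p) ×-dec (j <? q)) ×-dec ((i′ <? p) ×-dec (j′ <? q)) ×-dec
  (((i ≟ i′) ×-dec ((suc j ≟ j′) ⊎-dec (suc j′ ≟ j))) ⊎-dec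
   ((j ≟ j′) ×-dec ((suc i ≟ i′) ⊎-dec (suc i′ ≟ i))))

adj?-in-grid : ∀ {p q i j i′ j′} → i′ < p → j′ < q → i < p → j < q →
  does (adj? p q (i′ , j′) (i , j)) ≡ ((i′ ≡ᵇ i) ∧ pathAdj j′ j) xor ((j′ ≡ᵇ j) ∧ pathAdj i′ i)
adj?-in-grid {p} {q} {i} {j} {i′} {j′} i′<p j′<q i<p j<q
  rewrite <⇒<ᵇ′ i′<p | <⇒<ᵇ′ j′<q | <⇒<ᵇ′ i<p | <⇒<ᵇ′ j<q =
  ∨⇒xor ((i′ ≡ᵇ i) ∧ pathAdj j′ j) ((j′ ≡ᵇ j) ∧ pathAdj i′ i)
    (exclusive (i′ ≡ᵇ i) (pathAdj j′ j) (j′ ≡ᵇ j) (pathAdj i′ i) (pathAdj-irrefl j′ j))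
  where
  exclusive : ∀ a P b Q → b ∧ P ≡ false → (a ∧ P) ∧ (b ∧ Q) ≡ false
  exclusive a false b Q _ = cong (_∧ (b ∧ Q)) (∧-zeroʳ a)
  exclusive a true false Q _ = ∧-zeroʳ (a ∧ true)

module _ {a} {A : Set a} (_≺_ : A → A → Bool) where

  gridInDegree-parity : ∀ p q (f : Vertex → A) i j → i < p → j < q →
    gridParity (λ x → does (adj? p q x (i , j)) ∧ (f x ≺ f (i , j))) p q ≡
    pathDeg _≺_ p (λ i′ → f (i′ , j)) i xor pathDeg _≺_ q (λ j′ → f (i , j′)) j
  gridInDegree-parity p q f i j i<p j<q = begin
    xorUpTo (λ i′ → xorUpTo (λ j′ → does (adj? p q (i′ , j′) (i , j)) ∧ below i′ j′) q) p
      ≡⟨ xorUpTo-cong p (λ i′ i′<p → xorUpTo-cong q (λ j′ j′<q → split i′ j′ i′<p j′<q)) ⟩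
    xorUpTo (λ i′ → xorUpTo (λ j′ → ((i′ ≡ᵇ i) ∧ colTerm i′ j′) xor ((j′ ≡ᵇ j) ∧ rowTerm i′ j′)) q) p
      ≡⟨ xorUpTo-cong p (λ i′ _ → xorUpTo-xor _ _ q) ⟩
    xorUpTo (λ i′ → xorUpTo (λ j′ → (i′ ≡ᵇ i) ∧ colTerm i′ j′) q xor
                    xorUpTo (λ j′ → (j′ ≡ᵇ j) ∧ rowTerm i′ j′) q) p
      ≡⟨ xorUpTo-cong p (λ i′ _ →
           cong₂ _xor_ (xorUpTo-∧ˡ (i′ ≡ᵇ i) (colTerm i′) q) (xorUpTo-delta j (rowTerm i′) q)) ⟩
    xorUpTo (λ i′ → ((i′ ≡ᵇ i) ∧ xorUpTo (colTerm i′) q) xor ((j <ᵇ q) ∧ rowTerm i′ j)) p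
      ≡⟨ xorUpTo-xor _ _ p ⟩
    xorUpTo (λ i′ → (i′ ≡ᵇ i) ∧ xorUpTo (colTerm i′) q) p xor xorUpTo (λ i′ → (j <ᵇ q) ∧ rowTerm i′ j) p
      ≡⟨ cong₂ _xor_ (xorUpTo-delta i (λ i′ → xorUpTo (colTerm i′) q) p)
                     (xorUpTo-∧ˡ (j <ᵇ q) (λ i′ → rowTerm i′ j) p) ⟩
    ((i <ᵇ p) ∧ xorUpTo (colTerm i) q) xor ((j <ᵇ q) ∧ xorUpTo (λ i′ → rowTerm i′ j) p)
      ≡⟨ cong₂ (λ x y → (x ∧ xorUpTo (colTerm i) q) xor (y ∧ xorUpTo (λ i′ → rowTerm i′ j) p))
               (<⇒<ᵇ′ i<p) (<⇒<ᵇ′ j<q) ⟩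
    xorUpTo (colTerm i) q xor xorUpTo (λ i′ → rowTerm i′ j) p
      ≡⟨ cong₂ _xor_ (xorUpTo-pathAdj _≺_ q (λ j′ → f (i , j′)) j j<q)
                     (xorUpTo-pathAdj _≺_ p (λ i′ → f (i′ , j)) i i<p) ⟩
    pathDeg _≺_ q (λ j′ → f (i , j′)) j xor pathDeg _≺_ p (λ i′ → f (i′ , j)) i
      ≡⟨ xor-comm (pathDeg _≺_ q (λ j′ → f (i , j′)) j) _ ⟩
    pathDeg _≺_ p (λ i′ → f (i′ , j)) i xor pathDeg _≺_ q (λ j′ → f (i , j′)) j ∎
    where
    open ≡-Reasoning
    below : ℕ → ℕ → Bool
    below i′ j′ = f (i′ , j′) ≺ f (i , j)
    colTerm rowTerm : ℕ → ℕ → Bool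
    colTerm i′ j′ = pathAdj j′ j ∧ below i′ j′
    rowTerm i′ j′ = pathAdj i′ i ∧ below i′ j′
    split : ∀ i′ j′ → i′ < p → j′ < q →
      does (adj? p q (i′ , j′) (i , j)) ∧ below i′ j′ ≡
      ((i′ ≡ᵇ i) ∧ colTerm i′ j′) xor ((j′ ≡ᵇ j) ∧ rowTerm i′ j′)
    split i′ j′ i′<p j′<q = trans (cong (_∧ below i′ j′) (adj?-in-grid i′<p j′<q i<p j<q))
      (distrib (i′ ≡ᵇ i) (pathAdj j′ j) (j′ ≡ᵇ j) (pathAdj i′ i) (below i′ j′))
      where
      distrib : ∀ a b d e c → ((a ∧ b) xor (d ∧ e)) ∧ c ≡ (a ∧ (b ∧ c)) xor (d ∧ (e ∧ c))
      distrib = solve 5 (λ a b d e c → ((a :* b) :+ (d :* e)) :* c := (a :* (b :* c)) :+ (d :* (e :* c))) refl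

Adj-sym : ∀ {p q x y} → Adj p q x y → Adj p q y x
Adj-sym (x∈ , y∈ , inj₁ (i≡i′ , inj₁ e)) = y∈ , x∈ , inj₁ (sym i≡i′ , inj₂ e)
Adj-sym (x∈ , y∈ , inj₁ (i≡i′ , inj₂ e)) = y∈ , x∈ , inj₁ (sym i≡i′ , inj₁ e)
Adj-sym (x∈ , y∈ , inj₂ (j≡j′ , inj₁ e)) = y∈ , x∈ , inj₂ (sym j≡j′ , inj₂ e)
Adj-sym (x∈ , y∈ , inj₂ (j≡j′ , inj₂ e)) = y∈ , x∈ , inj₂ (sym j≡j′ , inj₁ e)

-- Rankings

module Ranking {c ℓ₁ ℓ₂} (O : StrictTotalOrder c ℓ₁ ℓ₂) where

  open StrictTotalOrder O public using (_≈_) renaming (Carrier to Rank)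
  open StrictTotalOrder O
    using (compare; irrefl; asym; module Eq)
    renaming (_<_ to _<ʳ_; _<?_ to _<ʳ?_; trans to <ʳ-trans)

  infix 4 _≺_
  _≺_ : Rank → Rank → Bool
  x ≺ y = does (x <ʳ? y)

  ≺-flip : ∀ {x y} → ¬ x ≈ y → (x ≺ y) ≡ not (y ≺ x)
  ≺-flip {x} {y} x≉y = from-tri (compare x y)
    where
    from-tri : Tri (x <ʳ y) (x ≈ y) (y <ʳ x) → (x ≺ y) ≡ not (y ≺ x)
    from-tri (tri< x<y _ y≮x) = trans (dec-true (x <ʳ? y) x<y) (cong not (sym (dec-false (y <ʳ? x) y≮x)))
    from-tri (tri≈ _ x≈y _) = ⊥-elim (x≉y x≈y)
    from-tri (tri> x≮y _ y<x) = trans (dec-false (x <ʳ? y) x≮y) (cong not (sym (dec-true (y <ʳ? x) y<x)))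

  <⇒≺ : ∀ {x y} → x <ʳ y → (x ≺ y) ≡ true
  <⇒≺ {x} {y} x<y = dec-true (x <ʳ? y) x<y

  <⇒⊀ : ∀ {x y} → x <ʳ y → (y ≺ x) ≡ false
  <⇒⊀ {x} {y} x<y = dec-false (y <ʳ? x) (asym x<y)

  <⇒≉ : ∀ {x y} → x <ʳ y → ¬ x ≈ y
  <⇒≉ x<y x≈y = irrefl x≈y x<y

  AdjacentDistinct : ℕ → (ℕ → Rank) → Set ℓ₁
  AdjacentDistinct n f = ∀ k → suc k < n → ¬ f k ≈ f (suc k)

  AdjacentDistinct-≗ : ∀ n {f g} → (∀ i → f i ≡ g i) → AdjacentDistinct n g → AdjacentDistinct n f
  AdjacentDistinct-≗ n f≗g distinct k 1+k<n rewrite f≗g k | f≗g (suc k) = distinct k 1+k<n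

  record TOddRanking (p q : ℕ) (T : Subset) : Set (c ⊔ ℓ₁) where
    field
      rank : Vertex → Rank
      rows-distinct : ∀ j → j < q → AdjacentDistinct p (λ i → rank (i , j))
      columns-distinct : ∀ i → i < p → AdjacentDistinct q (λ j → rank (i , j))
      parity : ∀ i j → i < p → j < q →
        pathDeg _≺_ p (λ i′ → rank (i′ , j)) i xor pathDeg _≺_ q (λ j′ → rank (i , j′)) j ≡ T (i , j)

  transpose : ∀ {p q T} → TOddRanking q p (T ∘ swap) → TOddRanking p q T
  transpose {p} {q} R = record
    { rank = rank ∘ swap
    ; rows-distinct = λ j j<q → columns-distinct j j<q
    ; columns-distinct = λ i i<p → rows-distinct i i<p
    ; parity = λ i j i<p j<q →
        trans (xor-comm (pathDeg _≺_ p (λ i′ → rank (j , i′)) i) _) (parity j i j<q i<p)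
    }
    where open TOddRanking R

  module _ {p q T} (R : TOddRanking p q T) where

    open TOddRanking R

    orientation : Vertex → Vertex → Bool
    orientation x y = does (adj? p q x y) ∧ (rank x ≺ rank y)

    adjacent-distinct : ∀ {x y} → Adj p q x y → ¬ rank x ≈ rank y
    adjacent-distinct ((i<p , _) , (_ , 1+j<q) , inj₁ (refl , inj₁ refl)) = columns-distinct _ i<p _ 1+j<q
    adjacent-distinct ((i<p , 1+j<q) , _ , inj₁ (refl , inj₂ refl)) = columns-distinct _ i<p _ 1+j<q ∘ Eq.sym
    adjacent-distinct ((_ , j<q) , (1+i<p , _) , inj₂ (refl , inj₁ refl)) = rows-distinct _ j<q _ 1+i<p
    adjacent-distinct ((1+i<p , j<q) , _ , inj₂ (refl , inj₂ refl)) = rows-distinct _ j<q _ 1+i<p ∘ Eq.sym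

    isOrientation : IsOrientation p q orientation
    isOrientation = antisymmetric , supported
      where
      antisymmetric : ∀ x y → Adj p q x y → orientation x y ≡ not (orientation y x)
      antisymmetric x y xy rewrite dec-true (adj? p q x y) xy | dec-true (adj? p q y x) (Adj-sym xy) =
        ≺-flip (adjacent-distinct xy)
      supported : ∀ x y → orientation x y ≡ true → Adj p q x y
      supported x y e = does-true⇒ (adj? p q x y) (proj₁ (∧-true e))

    walk⇒< : ∀ {x y} → DWalk orientation x y → rank x <ʳ rank y
    walk⇒< (step e) = does-true⇒ (_ <ʳ? _) (proj₂ (∧-true e))
    walk⇒< (cons e w) = <ʳ-trans (does-true⇒ (_ <ʳ? _) (proj₂ (∧-true e))) (walk⇒< w)

    isAcyclic : IsAcyclic orientation
    isAcyclic x w = irrefl Eq.refl (walk⇒< w)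

    isTOdd : IsTOdd p q T orientation
    isTOdd (i , j) (i<p , j<q) = (λ odd≡1 → indicator-injective (trans (sym in%2) odd≡1)) ,
                                 (λ Tv → trans in%2 (cong indicator Tv))
      where
      in%2 : inDegree p q orientation (i , j) % 2 ≡ indicator (T (i , j))
      in%2 = begin
        inDegree p q orientation (i , j) % 2     ≡⟨ n%2≡indicator[odd] (inDegree p q orientation (i , j)) ⟩
        indicator (odd (inDegree p q orientation (i , j)))
          ≡⟨ cong indicator (odd-count-vertices (λ x → orientation x (i , j)) p q) ⟩
        indicator (gridParity (λ x → orientation x (i , j)) p q)
          ≡⟨ cong indicator (gridInDegree-parity _≺_ p q rank i j i<p j<q) ⟩
        indicator (pathDeg _≺_ p (λ i′ → rank (i′ , j)) i xor pathDeg _≺_ q (λ j′ → rank (i , j′)) j)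
          ≡⟨ cong indicator (parity i j i<p j<q) ⟩
        indicator (T (i , j))                  ∎
        where open ≡-Reasoning
      indicator-injective : ∀ {b} → indicator b ≡ 1 → b ≡ true
      indicator-injective {true} _ = refl

    acyclicTOddOrientation : ∃[ D ] (IsOrientation p q D × IsTOdd p q T D × IsAcyclic D)
    acyclicTOddOrientation = orientation , isOrientation , isTOdd , isAcyclic

module Lex {a ℓ₁ ℓ₂ b ℓ₃ ℓ₄} (O₁ : StrictTotalOrder a ℓ₁ ℓ₂) (O₂ : StrictTotalOrder b ℓ₃ ℓ₄) where

  private
    module R₁ = Ranking O₁
    module R₂ = Ranking O₂
    module O₁ = StrictTotalOrder O₁
    module O₂ = StrictTotalOrder O₂
    module O₁×O₂ = StrictTotalOrder (×-strictTotalOrder O₁ O₂)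

  open Ranking (×-strictTotalOrder O₁ O₂) public

  ≺-same-first : ∀ u x y → ((u , x) ≺ (u , y)) ≡ (x R₂.≺ y)
  ≺-same-first u x y = does-⇔ (mk⇔ second (λ x<y → inj₂ (O₁.Eq.refl , x<y))) ((u , x) O₁×O₂.<? (u , y)) (x O₂.<? y)
    where
    second : ×-Lex O₁._≈_ O₁._<_ O₂._<_ (u , x) (u , y) → O₂._<_ x y
    second (inj₁ u<u) = ⊥-elim (O₁.irrefl O₁.Eq.refl u<u)
    second (inj₂ (_ , x<y)) = x<y

  ≺-differ-first : ∀ {u v} x y → ¬ u O₁.≈ v → ((u , x) ≺ (v , y)) ≡ (u R₁.≺ v)
  ≺-differ-first {u} {v} x y u≉v = does-⇔ (mk⇔ first inj₁) ((u , x) O₁×O₂.<? (v , y)) (u O₁.<? v)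
    where
    first : ×-Lex O₁._≈_ O₁._<_ O₂._<_ (u , x) (v , y) → u O₁.< v
    first (inj₁ u<v) = u<v
    first (inj₂ (u≈v , _)) = ⊥-elim (u≉v u≈v)

  orderedAlike-second : ∀ n u (g : ℕ → O₂.Carrier) →
    OrderedAlike _≺_ R₂._≺_ n (λ k → (u , g k)) g
  orderedAlike-second n u g k _ = ≺-same-first u (g k) (g (suc k)) , ≺-same-first u (g (suc k)) (g k)

  orderedAlike-first : ∀ n (f : ℕ → O₁.Carrier) (g : ℕ → O₂.Carrier) →
    R₁.AdjacentDistinct n f → OrderedAlike _≺_ R₁._≺_ n (λ k → (f k , g k)) f
  orderedAlike-first n f g distinct k 1+k<n =
    ≺-differ-first (g k) (g (suc k)) (distinct k 1+k<n) ,
    ≺-differ-first (g (suc k)) (g k) (distinct k 1+k<n ∘ O₁.Eq.sym)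

module ℕRanking = Ranking ℕ.<-strictTotalOrder

≺ℕ≡<ᵇ : ∀ m n → (m ℕRanking.≺ n) ≡ (m <ᵇ n)
≺ℕ≡<ᵇ m n = does-⇔ (mk⇔ id id) (StrictTotalOrder._<?_ ℕ.<-strictTotalOrder m n) (m <? n)

module ℤRanking = Ranking ℤ.<-strictTotalOrder
open ℤRanking using () renaming (_≺_ to _≺ℤ_)

heights : (ℕ → Bool) → ℕ → ℤ
heights s zero = 0ℤ
heights s (suc k) = if s k then sucℤ (heights s k) else predℤ (heights s k)

heights-step : ∀ s k → ((heights s k ≺ℤ heights s (suc k)) ≡ s k) ×
  ((heights s (suc k) ≺ℤ heights s k) ≡ not (s k)) × (heights s k ≢ heights s (suc k))
heights-step s k with s k
... | true = ℤRanking.<⇒≺ up , ℤRanking.<⇒⊀ up , ℤRanking.<⇒≉ up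
  where up = ℤ.suc[i]≤j⇒i<j ℤ.≤-refl
... | false = ℤRanking.<⇒⊀ down , ℤRanking.<⇒≺ down , ℤRanking.<⇒≉ down ∘ sym
  where down = ℤ.i≤pred[j]⇒i<j ℤ.≤-refl

-- Edge k points into k iff the parities required on 0 ⋯ k disagree with the k edges inside 0 ⋯ k.
forwardEdges : (ℕ → Bool) → ℕ → Bool
forwardEdges r k = not (xorUpTo r (suc k) xor odd k)

pathRank : (ℕ → Bool) → ℕ → ℤ
pathRank r = heights (forwardEdges r)

pathRank-distinct : ∀ r n → ℤRanking.AdjacentDistinct n (pathRank r)
pathRank-distinct r n k _ = proj₂ (proj₂ (heights-step (forwardEdges r) k))

pathRank-degree : ∀ n (r : ℕ → Bool) → xorUpTo r n ≡ not (odd n) →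
  ∀ k → k < n → pathDeg _≺ℤ_ n (pathRank r) k ≡ r k
pathRank-degree n r total k k<n = begin
  inFromLeft _≺ℤ_ W k xor inFromRight _≺ℤ_ n W k
    ≡⟨ cong₂ _xor_ (fromLeft k) (fromRight k<n) ⟩
  (xorUpTo r k xor odd k) xor (xorUpTo r (suc k) xor odd k)
    ≡⟨ cong (λ x → (xorUpTo r k xor odd k) xor (x xor odd k)) (xorUpTo-suc r k) ⟩
  (xorUpTo r k xor odd k) xor ((xorUpTo r k xor r k) xor odd k)
    ≡⟨ cancel (xorUpTo r k) (odd k) (r k) ⟩
  r k ∎
  where
  open ≡-Reasoning
  W = pathRank r
  fromLeft : ∀ k → inFromLeft _≺ℤ_ W k ≡ xorUpTo r k xor odd k
  fromLeft zero = refl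
  fromLeft (suc k) = trans (proj₁ (heights-step (forwardEdges r) k)) (not-distribʳ-xor (xorUpTo r (suc k)) (odd k))
  fromRight : k < n → inFromRight _≺ℤ_ n W k ≡ xorUpTo r (suc k) xor odd k
  fromRight k<n with m≤n⇒m<n∨m≡n k<n
  ... | inj₁ 1+k<n rewrite <⇒<ᵇ′ 1+k<n = trans (proj₁ (proj₂ (heights-step (forwardEdges r) k))) (not-involutive _)
  ... | inj₂ refl rewrite n<ᵇn (suc k) | total = sym (xor-not-not (odd k))
    where
    xor-not-not : ∀ b → not (not b) xor b ≡ false
    xor-not-not true = refl
    xor-not-not false = refl
  cancel : ∀ x o y → (x xor o) xor ((x xor y) xor o) ≡ y
  cancel = solve 3 (λ x o y → (x :+ o) :+ ((x :+ y) :+ o) := y) refl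

-- Grids of odd width

module ℤ²Ranking = Lex ℤ.<-strictTotalOrder ℤ.<-strictTotalOrder
open ℤ²Ranking using () renaming (TOddRanking to ℤ²TOddRanking)

oddWidthRanking : ∀ w h (r : Subset) → odd w ≡ true → gridParity r w h ≡ not (odd h) → ℤ²TOddRanking w h r
oddWidthRanking w h r odd-w total = record
  { rank = λ (k , m) → (rowRank m , withinRow m k)
  ; rows-distinct = λ m _ k 1+k<w → pathRank-distinct (rowTarget m) w k 1+k<w ∘ proj₂
  ; columns-distinct = λ k _ m 1+m<h → pathRank-distinct rowParity h m 1+m<h ∘ proj₁
  ; parity = parity
  }
  where
  open ≡-Reasoning
  rowParity : ℕ → Bool
  rowParity m = xorUpTo (λ k → r (k , m)) w
  rowRank : ℕ → ℤ
  rowRank = pathRank rowParity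
  rowRank-degree : ∀ m → m < h → pathDeg _≺ℤ_ h rowRank m ≡ rowParity m
  rowRank-degree = pathRank-degree h rowParity (trans (xorUpTo-swap (λ m k → r (k , m)) h w) total)
  rowTarget : ℕ → ℕ → Bool
  rowTarget m k = r (k , m) xor pathDeg _≺ℤ_ h rowRank m
  withinRow : ℕ → ℕ → ℤ
  withinRow m = pathRank (rowTarget m)
  withinRow-degree : ∀ m → m < h → ∀ k → k < w → pathDeg _≺ℤ_ w (withinRow m) k ≡ rowTarget m k
  withinRow-degree m m<h = pathRank-degree w (rowTarget m) (begin
    xorUpTo (rowTarget m) w                                    ≡⟨ xorUpTo-xor _ _ w ⟩
    rowParity m xor xorUpTo (λ _ → pathDeg _≺ℤ_ h rowRank m) w ≡⟨ cong (rowParity m xor_) (xorUpTo-const _ w) ⟩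
    rowParity m xor (pathDeg _≺ℤ_ h rowRank m ∧ odd w)
      ≡⟨ cong (λ x → rowParity m xor (x ∧ odd w)) (rowRank-degree m m<h) ⟩
    rowParity m xor (rowParity m ∧ odd w)                      ≡⟨ cong (λ x → rowParity m xor (rowParity m ∧ x)) odd-w ⟩
    rowParity m xor (rowParity m ∧ true)                       ≡⟨ xor-∧-true-self (rowParity m) ⟩
    false                                                      ≡⟨ cong not (sym odd-w) ⟩
    not (odd w)                                                ∎)
    where
    xor-∧-true-self : ∀ b → b xor (b ∧ true) ≡ false
    xor-∧-true-self true = refl
    xor-∧-true-self false = refl
  parity : ∀ k m → k < w → m < h →
    pathDeg ℤ²Ranking._≺_ w (λ k′ → (rowRank m , withinRow m k′)) k xor
    pathDeg ℤ²Ranking._≺_ h (λ m′ → (rowRank m′ , withinRow m′ k)) m ≡ r (k , m)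
  parity k m k<w m<h = begin
    pathDeg ℤ²Ranking._≺_ w (λ k′ → (rowRank m , withinRow m k′)) k xor
    pathDeg ℤ²Ranking._≺_ h (λ m′ → (rowRank m′ , withinRow m′ k)) m
      ≡⟨ cong₂ _xor_
           (pathDeg-cong _ _ w _ _ (ℤ²Ranking.orderedAlike-second w (rowRank m) (withinRow m)) k k<w)
           (pathDeg-cong _ _ h _ _ (ℤ²Ranking.orderedAlike-first h rowRank (λ m′ → withinRow m′ k)
              (pathRank-distinct rowParity h)) m m<h) ⟩
    pathDeg _≺ℤ_ w (withinRow m) k xor pathDeg _≺ℤ_ h rowRank m
      ≡⟨ cong (_xor pathDeg _≺ℤ_ h rowRank m) (withinRow-degree m m<h k k<w) ⟩
    (r (k , m) xor pathDeg _≺ℤ_ h rowRank m) xor pathDeg _≺ℤ_ h rowRank m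
      ≡⟨ xor-cancelʳ (r (k , m)) _ ⟩
    r (k , m) ∎
    where
    xor-cancelʳ : ∀ x y → (x xor y) xor y ≡ x
    xor-cancelʳ = solve 2 (λ x y → (x :+ y) :+ y := x) refl

-- Four blocks

module Gluing {c ℓ₁ ℓ₂} (O : StrictTotalOrder c ℓ₁ ℓ₂) where

  private
    module B = Ranking O
    module O = StrictTotalOrder O

  open Lex ℕ.<-strictTotalOrder O public

  ≉-resp : ∀ {x x′ y y′} → x ≡ x′ → y ≡ y′ → ¬ x′ ≈ y′ → ¬ x ≈ y
  ≉-resp refl refl x≉y = x≉y

  glue : ℕ → (Bool → ℕ) → (Bool → ℕ → O.Carrier) → ℕ → ℕ × O.Carrier
  glue c β g i = (β (side c i) , g (side c i) (local c i))

  module _ {n c} (β : Bool → ℕ) (g : Bool → ℕ → O.Carrier) (0<c : 0 < c) (c<n : c < n) where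

    glue-segment : ∀ h k → k < segLength n c h → glue c β g (offset c h + k) ≡ (β h , g h k)
    glue-segment h k k< = cong₂ (λ s l → (β s , g s l)) (side-offset {n} h k k<) (local-offset {n} h k k<)

    glue-at-cut : glue c β g c ≡ (β true , g true 0)
    glue-at-cut = trans (cong (glue c β g) (sym (+-identityʳ c)))
      (glue-segment true 0 (subst (_< n ∸ c) (n∸n≡0 c) (∸-monoˡ-< c<n ≤-refl)))

    glue-before-cut : glue c β g (c ∸ 1) ≡ (β false , g false (c ∸ 1))
    glue-before-cut = glue-segment false (c ∸ 1) (pred< 0<c)
      where
      pred< : ∀ {c} → 0 < c → c ∸ 1 < c
      pred< (s≤s _) = ≤-refl

    segment-orderedAlike : ∀ h →
      OrderedAlike _≺_ B._≺_ (segLength n c h) (λ k → glue c β g (offset c h + k)) (g h)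
    segment-orderedAlike h k 1+k< =
      trans (cong₂ _≺_ (glue-segment h k k<) (glue-segment h (suc k) 1+k<)) (≺-same-first (β h) (g h k) (g h (suc k))) ,
      trans (cong₂ _≺_ (glue-segment h (suc k) 1+k<) (glue-segment h k k<)) (≺-same-first (β h) (g h (suc k)) (g h k))
      where k< = <-trans (n<1+n k) 1+k<

    module _ (β-cut : β false ≢ β true) where

      glue-pathDeg : ∀ h k → k < segLength n c h →
        pathDeg _≺_ n (glue c β g) (offset c h + k) ≡
        pathDeg B._≺_ (segLength n c h) (g h) k xor (atCut c h k ∧ (β (not h) <ᵇ β h))
      glue-pathDeg false k k<c = trans (pathDeg-prefix _≺_ (glue c β g) k c<n k<c)
        (cong₂ _xor_ (pathDeg-cong _≺_ B._≺_ c _ (g false) (segment-orderedAlike false) k k<c)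
                     (∧-congˡ-if (suc k ≡ᵇ c) cut-edge))
        where
        cut-edge : (suc k ≡ᵇ c) ≡ true → (glue c β g (suc k) ≺ glue c β g k) ≡ (β true <ᵇ β false)
        cut-edge 1+k≡c with refl ← ≡ᵇ⇒≡′ {suc k} {c} 1+k≡c =
          trans (cong₂ _≺_ glue-at-cut (glue-segment false k k<c))
            (trans (≺-differ-first (g true 0) (g false k) (β-cut ∘ sym)) (≺ℕ≡<ᵇ (β true) (β false)))
      glue-pathDeg true k k< = trans (pathDeg-suffix _≺_ (glue c β g) k 0<c)
        (cong₂ _xor_ (pathDeg-cong _≺_ B._≺_ (n ∸ c) _ (g true) (segment-orderedAlike true) k k<)
                     (∧-congˡ-if (k ≡ᵇ 0) (λ _ →
                       trans (cong₂ _≺_ glue-before-cut glue-at-cut)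
                         (trans (≺-differ-first (g false (c ∸ 1)) (g true 0) β-cut) (≺ℕ≡<ᵇ (β false) (β true))))))

      glue-distinct : (∀ h → B.AdjacentDistinct (segLength n c h) (g h)) → AdjacentDistinct n (glue c β g)
      glue-distinct distinct i 1+i<n with position-view {n} {c} (<⇒≤ c<n) (<-trans (n<1+n i) 1+i<n)
      ... | position false k k<c with m≤n⇒m<n∨m≡n k<c
      ...   | inj₁ 1+k<c = ≉-resp (glue-segment false k k<c) (glue-segment false (suc k) 1+k<c)
                                  (distinct false k 1+k<c ∘ proj₂)
      ...   | inj₂ refl = ≉-resp (glue-segment false k k<c) glue-at-cut (β-cut ∘ proj₁)
      glue-distinct distinct _ 1+i<n | position true k k< =
        ≉-resp (glue-segment true k k<) (trans (cong (glue c β g) (sym (+-suc c k))) (glue-segment true (suc k) 1+k<))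
               (distinct true k 1+k< ∘ proj₂)
        where
        1+k< : suc k < n ∸ c
        1+k< = subst (_< n ∸ c) (m+n∸m≡n c (suc k)) (∸-monoˡ-< (subst (_< n) (sym (+-suc c k)) 1+i<n) (m≤m+n c (suc k)))

  module Cut {p q a b} (0<a : 0 < a) (a<p : a < p) (0<b : 0 < b) (b<q : b < q) (β : Bool → Bool → ℕ) where

    -- The in-degree parity that local position (k , m) of block (h , w) receives across the cuts.
    crossing : Bool → Bool → Vertex → Bool
    crossing h w (k , m) = (atCut a h k ∧ (β (not h) w <ᵇ β h w)) xor (atCut b w m ∧ (β h (not w) <ᵇ β h w))

    blockTarget : Subset → Bool → Bool → Subset
    blockTarget T h w (k , m) = T (offset a h + k , offset b w + m) xor crossing h w (k , m)

    glueRanking : ∀ {T} → (∀ w → β false w ≢ β true w) → (∀ h → β h false ≢ β h true) →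
      (∀ h w → B.TOddRanking (segLength p a h) (segLength q b w) (blockTarget T h w)) → TOddRanking p q T
    glueRanking {T} β-rows β-columns blocks = record
      { rank = rank
      ; rows-distinct = rows-distinct
      ; columns-distinct = columns-distinct
      ; parity = parity
      }
      where
      blockRank : Bool → Bool → Vertex → O.Carrier
      blockRank h w = B.TOddRanking.rank (blocks h w)

      rank : Vertex → ℕ × O.Carrier
      rank (i , j) = glue a (λ h → β h (side b j)) (λ h k → blockRank h (side b j) (k , local b j)) i

      rowLine : ∀ w m → m < segLength q b w → ∀ i →
        rank (i , offset b w + m) ≡ glue a (λ h → β h w) (λ h k → blockRank h w (k , m)) i
      rowLine w m m< i = cong₂ (λ w′ m′ → glue a (λ h → β h w′) (λ h k → blockRank h w′ (k , m′)) i)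
        (side-offset {q} w m m<) (local-offset {q} w m m<)

      columnLine : ∀ h k → k < segLength p a h → ∀ j →
        rank (offset a h + k , j) ≡ glue b (β h) (λ w m → blockRank h w (k , m)) j
      columnLine h k k< j = cong₂ (λ h′ k′ → glue b (β h′) (λ w m → blockRank h′ w (k′ , m)) j)
        (side-offset {p} h k k<) (local-offset {p} h k k<)

      rows-distinct : ∀ j → j < q → AdjacentDistinct p (λ i → rank (i , j))
      rows-distinct j j<q with position-view {q} {b} (<⇒≤ b<q) j<q
      ... | position w m m< = AdjacentDistinct-≗ p (rowLine w m m<)
        (glue-distinct (λ h → β h w) (λ h k → blockRank h w (k , m)) 0<a a<p (β-rows w)
           (λ h → B.TOddRanking.rows-distinct (blocks h w) m m<))

      columns-distinct : ∀ i → i < p → AdjacentDistinct q (λ j → rank (i , j))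
      columns-distinct i i<p with position-view {p} {a} (<⇒≤ a<p) i<p
      ... | position h k k< = AdjacentDistinct-≗ q (columnLine h k k<)
        (glue-distinct (β h) (λ w m → blockRank h w (k , m)) 0<b b<q (β-columns h)
           (λ w → B.TOddRanking.columns-distinct (blocks h w) k k<))

      parity : ∀ i j → i < p → j < q →
        pathDeg _≺_ p (λ i′ → rank (i′ , j)) i xor pathDeg _≺_ q (λ j′ → rank (i , j′)) j ≡ T (i , j)
      parity i j i<p j<q with position-view {p} {a} (<⇒≤ a<p) i<p | position-view {q} {b} (<⇒≤ b<q) j<q
      ... | position h k k< | position w m m< = begin
        pathDeg _≺_ p (λ i′ → rank (i′ , offset b w + m)) (offset a h + k) xor
        pathDeg _≺_ q (λ j′ → rank (offset a h + k , j′)) (offset b w + m)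
          ≡⟨ cong₂ _xor_ (pathDeg-≗ _≺_ p (rowLine w m m<) (offset a h + k))
                         (pathDeg-≗ _≺_ q (columnLine h k k<) (offset b w + m)) ⟩
        pathDeg _≺_ p (glue a (λ h′ → β h′ w) (λ h′ k′ → blockRank h′ w (k′ , m))) (offset a h + k) xor
        pathDeg _≺_ q (glue b (β h) (λ w′ m′ → blockRank h w′ (k , m′))) (offset b w + m)
          ≡⟨ cong₂ _xor_ (glue-pathDeg (λ h′ → β h′ w) (λ h′ k′ → blockRank h′ w (k′ , m)) 0<a a<p (β-rows w) h k k<)
                         (glue-pathDeg (β h) (λ w′ m′ → blockRank h w′ (k , m′)) 0<b b<q (β-columns h) w m m<) ⟩
        (rowDeg xor (atCut a h k ∧ (β (not h) w <ᵇ β h w))) xor (columnDeg xor (atCut b w m ∧ (β h (not w) <ᵇ β h w)))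
          ≡⟨ interchange rowDeg _ columnDeg _ ⟩
        (rowDeg xor columnDeg) xor crossing h w (k , m)
          ≡⟨ cong (_xor crossing h w (k , m)) (B.TOddRanking.parity (blocks h w) k m k< m<) ⟩
        (T (offset a h + k , offset b w + m) xor crossing h w (k , m)) xor crossing h w (k , m)
          ≡⟨ xor-cancelʳ (T (offset a h + k , offset b w + m)) (crossing h w (k , m)) ⟩
        T (offset a h + k , offset b w + m) ∎
        where
        open ≡-Reasoning
        rowDeg = pathDeg B._≺_ (segLength p a h) (λ k′ → blockRank h w (k′ , m)) k
        columnDeg = pathDeg B._≺_ (segLength q b w) (λ m′ → blockRank h w (k , m′)) m
        interchange : ∀ a b c d → (a xor b) xor (c xor d) ≡ (a xor c) xor (b xor d)
        interchange = solve 4 (λ a b c d → (a :+ b) :+ (c :+ d) := (a :+ c) :+ (b :+ d)) refl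
        xor-cancelʳ : ∀ x y → (x xor y) xor y ≡ x
        xor-cancelʳ = solve 2 (λ x y → (x :+ y) :+ y := x) refl

    crossing-parity : ∀ h w → odd (segLength p a h) ≡ true → odd (segLength q b w) ≡ true →
      gridParity (crossing h w) (segLength p a h) (segLength q b w) ≡
      (β (not h) w <ᵇ β h w) xor (β h (not w) <ᵇ β h w)
    crossing-parity h w odd-width odd-height = begin
      gridParity (crossing h w) (segLength p a h) (segLength q b w)
        ≡⟨ gridParity-separable (λ k → atCut a h k ∧ X) (λ m → atCut b w m ∧ Y) (segLength p a h) (segLength q b w) ⟩
      (xorUpTo (λ k → atCut a h k ∧ X) (segLength p a h) ∧ odd (segLength q b w)) xor
      (odd (segLength p a h) ∧ xorUpTo (λ m → atCut b w m ∧ Y) (segLength q b w))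
        ≡⟨ cong₂ (λ x y → (x ∧ odd (segLength q b w)) xor (odd (segLength p a h) ∧ y))
             (trans (xorUpTo-∧ʳ (atCut a h) X (segLength p a h)) (cong (_∧ X) (xorUpTo-atCut 0<a a<p h)))
             (trans (xorUpTo-∧ʳ (atCut b w) Y (segLength q b w)) (cong (_∧ Y) (xorUpTo-atCut 0<b b<q w))) ⟩
      (X ∧ odd (segLength q b w)) xor (odd (segLength p a h) ∧ Y)
        ≡⟨ cong₂ (λ x y → (X ∧ x) xor (y ∧ Y)) odd-height odd-width ⟩
      (X ∧ true) xor (true ∧ Y)
        ≡⟨ cong (_xor Y) (∧-identityʳ X) ⟩
      X xor Y ∎
      where
      open ≡-Reasoning
      X = β (not h) w <ᵇ β h w
      Y = β h (not w) <ᵇ β h w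

-- The four blocks form a 4-cycle. Relative to a block (h₀ , w₀) of even parity, a block at
-- offsets (dh , dw) is ranked 0 if it is (h₀ , w₀), 2 if it is the opposite block, and 1 or 3
-- as its parity is odd or even otherwise; the opposite block then receives the right parity
-- because the total parity is even.
cyclePosition : Bool → Bool → Bool → ℕ
cyclePosition false false _ = 0
cyclePosition true true _ = 2
cyclePosition false true odd-block = if odd-block then 1 else 3
cyclePosition true false odd-block = if odd-block then 1 else 3

blockOrder : (Bool → Bool → Bool) → Bool → Bool → Bool → Bool → ℕ
blockOrder t h₀ w₀ h w = cyclePosition (h xor h₀) (w xor w₀) (t h w)

odd-cyclePosition : ∀ dh dw x → odd (cyclePosition dh dw x) ≡ dh xor dw
odd-cyclePosition false false _ = refl
odd-cyclePosition true true _ = refl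
odd-cyclePosition false true true = refl
odd-cyclePosition false true false = refl
odd-cyclePosition true false true = refl
odd-cyclePosition true false false = refl

module _ (t : Bool → Bool → Bool) (h₀ w₀ : Bool) where

  private
    β = blockOrder t h₀ w₀

  blockOrder-distinct-rows : ∀ w → β false w ≢ β true w
  blockOrder-distinct-rows w β≡ = differ h₀ (w xor w₀) (trans (sym (odd-cyclePosition h₀ (w xor w₀) (t false w)))
    (trans (cong odd β≡) (odd-cyclePosition (not h₀) (w xor w₀) (t true w))))
    where
    differ : ∀ x y → x xor y ≢ not x xor y
    differ true true ()
    differ true false ()
    differ false true ()
    differ false false ()

  blockOrder-distinct-columns : ∀ h → β h false ≢ β h true
  blockOrder-distinct-columns h β≡ = differ (h xor h₀) w₀ (trans (sym (odd-cyclePosition (h xor h₀) w₀ (t h false)))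
    (trans (cong odd β≡) (odd-cyclePosition (h xor h₀) (not w₀) (t h true))))
    where
    differ : ∀ x y → x xor y ≢ x xor not y
    differ true true ()
    differ true false ()
    differ false true ()
    differ false false ()

  blockOrder-parity : t h₀ w₀ ≡ false →
    (t false false xor t false true) xor (t true false xor t true true) ≡ false →
    ∀ h w → (β (not h) w <ᵇ β h w) xor (β h (not w) <ᵇ β h w) ≡ t h w
  blockOrder-parity even₀ total h w
    rewrite sym (not-distribˡ-xor h h₀) | sym (not-distribˡ-xor w w₀)
    with h xor h₀ in dh | w xor w₀ in dw
  ... | false | false = trans (corner (t (not h) w) (t h (not w)))
    (sym (trans (cong₂ t (sym (xor-false h h₀ dh)) (sym (xor-false w w₀ dw))) even₀))
    where
    corner : ∀ x y → (cyclePosition true false x <ᵇ 0) xor (cyclePosition false true y <ᵇ 0) ≡ false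
    corner true true = refl
    corner true false = refl
    corner false true = refl
    corner false false = refl
  ... | true | false = beside (t h w)
    where
    beside : ∀ x → (0 <ᵇ cyclePosition true false x) xor (2 <ᵇ cyclePosition true false x) ≡ x
    beside true = refl
    beside false = refl
  ... | false | true = beside (t h w)
    where
    beside : ∀ x → (2 <ᵇ cyclePosition false true x) xor (0 <ᵇ cyclePosition false true x) ≡ x
    beside true = refl
    beside false = refl
  ... | true | true = begin
    (cyclePosition false true (t (not h) w) <ᵇ 2) xor (cyclePosition true false (t h (not w)) <ᵇ 2)
      ≡⟨ cong₂ _xor_ (below-opposite (t (not h) w)) (below-opposite (t h (not w))) ⟩
    t (not h) w xor t h (not w)
      ≡⟨ sym (xor-identityʳ _) ⟩
    (t (not h) w xor t h (not w)) xor false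
      ≡⟨ cong ((t (not h) w xor t h (not w)) xor_)
           (sym (trans (cong₂ t (sym (xor-true h h₀ dh)) (sym (xor-true w w₀ dw))) even₀)) ⟩
    (t (not h) w xor t h (not w)) xor t (not h) (not w)
      ≡⟨ sym (cycle-parity h w) ⟩
    t h w ∎
    where
    open ≡-Reasoning
    below-opposite : ∀ x → (cyclePosition false true x <ᵇ 2) ≡ x
    below-opposite true = refl
    below-opposite false = refl
    t₀₀ = t false false
    t₀₁ = t false true
    t₁₀ = t true false
    t₁₁ = t true true
    rearrange : ∀ h w → t h w xor ((t₀₀ xor t₀₁) xor (t₁₀ xor t₁₁)) ≡
                        (t (not h) w xor t h (not w)) xor t (not h) (not w)
    rearrange false false = solve 4 (λ a b c d → a :+ ((a :+ b) :+ (c :+ d)) := (c :+ b) :+ d) refl t₀₀ t₀₁ t₁₀ t₁₁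
    rearrange false true = solve 4 (λ a b c d → b :+ ((a :+ b) :+ (c :+ d)) := (d :+ a) :+ c) refl t₀₀ t₀₁ t₁₀ t₁₁
    rearrange true false = solve 4 (λ a b c d → c :+ ((a :+ b) :+ (c :+ d)) := (a :+ d) :+ b) refl t₀₀ t₀₁ t₁₀ t₁₁
    rearrange true true = solve 4 (λ a b c d → d :+ ((a :+ b) :+ (c :+ d)) := (b :+ c) :+ a) refl t₀₀ t₀₁ t₁₀ t₁₁
    cycle-parity : ∀ h w → t h w ≡ (t (not h) w xor t h (not w)) xor t (not h) (not w)
    cycle-parity h w = trans (sym (trans (cong (t h w xor_) total) (xor-identityʳ (t h w)))) (rearrange h w)

module ℤ²Gluing = Gluing (×-strictTotalOrder ℤ.<-strictTotalOrder ℤ.<-strictTotalOrder)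

blockParity : Subset → ℕ → ℕ → ℕ → ℕ → Bool → Bool → Bool
blockParity T p q a b h w =
  gridParity (λ (k , m) → T (offset a h + k , offset b w + m)) (segLength p a h) (segLength q b w)

gridParity-blocks : ∀ T {p q a b} → a ≤ p → b ≤ q → let t = blockParity T p q a b in
  gridParity T p q ≡ (t false false xor t false true) xor (t true false xor t true true)
gridParity-blocks T {p} {q} {a} {b} a≤p b≤q = begin
  xorUpTo rowSum p
    ≡⟨ cong (xorUpTo rowSum) (sym (m+[n∸m]≡n a≤p)) ⟩
  xorUpTo rowSum (a + (p ∸ a))
    ≡⟨ xorUpTo-+ rowSum a (p ∸ a) ⟩
  xorUpTo rowSum a xor xorUpTo (λ k → rowSum (a + k)) (p ∸ a)
    ≡⟨ cong₂ _xor_ (split (λ k → k) a) (split (a +_) (p ∸ a)) ⟩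
  _ ∎
  where
  open ≡-Reasoning
  rowSum : ℕ → Bool
  rowSum i = xorUpTo (λ j → T (i , j)) q
  split : ∀ (g : ℕ → ℕ) n → xorUpTo (λ k → rowSum (g k)) n ≡
    xorUpTo (λ k → xorUpTo (λ m → T (g k , m)) b) n xor xorUpTo (λ k → xorUpTo (λ m → T (g k , b + m)) (q ∸ b)) n
  split g n = trans
    (xorUpTo-cong n (λ k _ → trans (cong (xorUpTo (λ j → T (g k , j))) (sym (m+[n∸m]≡n b≤q)))
                                   (xorUpTo-+ (λ j → T (g k , j)) b (q ∸ b))))
    (xorUpTo-xor _ _ n)

crossRanking : ∀ {p q a b T} → 0 < a → a < p → 0 < b → b < q →
  (∀ h → odd (segLength p a h) ≡ true) → (∀ w → odd (segLength q b w) ≡ true) →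
  gridParity T p q ≡ false → (∃[ h ] ∃[ w ] blockParity T p q a b h w ≡ false) →
  ℤ²Gluing.TOddRanking p q T
crossRanking {p} {q} {a} {b} {T} 0<a a<p 0<b b<q odd-widths odd-heights even (h₀ , w₀ , even₀) =
  glueRanking (blockOrder-distinct-rows t h₀ w₀) (blockOrder-distinct-columns t h₀ w₀) block
  where
  open ℤ²Gluing
  t = blockParity T p q a b
  β = blockOrder t h₀ w₀
  open ℤ²Gluing.Cut 0<a a<p 0<b b<q β
  block : ∀ h w → ℤ²TOddRanking (segLength p a h) (segLength q b w) (blockTarget T h w)
  block h w = oddWidthRanking _ _ _ (odd-widths h) (begin
    gridParity (blockTarget T h w) (segLength p a h) (segLength q b w)
      ≡⟨ gridParity-xor _ (crossing h w) (segLength p a h) (segLength q b w) ⟩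
    t h w xor gridParity (crossing h w) (segLength p a h) (segLength q b w)
      ≡⟨ cong (t h w xor_) (crossing-parity h w (odd-widths h) (odd-heights w)) ⟩
    t h w xor ((β (not h) w <ᵇ β h w) xor (β h (not w) <ᵇ β h w))
      ≡⟨ cong (t h w xor_) (blockOrder-parity t h₀ w₀ even₀
           (trans (sym (gridParity-blocks T (<⇒≤ a<p) (<⇒≤ b<q))) even) h w) ⟩
    t h w xor t h w
      ≡⟨ xor-same (t h w) ⟩
    false
      ≡⟨ cong not (sym (odd-heights w)) ⟩
    not (odd (segLength q b w)) ∎)
    where open ≡-Reasoning

-- Bad paths

segmentParity : (ℕ → Bool) → ℕ → ℕ → Bool → Bool
segmentParity r n c h = xorUpTo (λ k → r (offset c h + k)) (segLength n c h)

module _ (r : ℕ → Bool) where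

  badPath-from-odd-cuts : ∀ n → 1 ≤ n → odd n ≡ false →
    (∀ c → c < n → odd c ≡ true → ∀ h → segmentParity r n c h ≡ true) → BadPath n r
  badPath-from-odd-cuts (suc (suc n)) _ odd-n odd-cuts =
    trans (n%2≡indicator[odd] (suc (suc n))) (cong indicator odd-n) , s≤s z≤n , first , last , pairs
    where
    odd-prefix : ∀ c → c < suc (suc n) → odd c ≡ true → xorUpTo r c ≡ true
    odd-prefix c c< odd-c = odd-cuts c c< odd-c false
    first : r 0 ≡ true
    first = trans (sym (xor-identityʳ (r 0))) (odd-prefix 1 (s≤s (s≤s z≤n)) refl)
    last : r (suc n) ≡ true
    last = begin
      r (suc n)                                            ≡⟨ cong r (sym (+-identityʳ (suc n))) ⟩
      r (suc n + 0)                                        ≡⟨ sym (xor-identityʳ _) ⟩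
      xorUpTo (λ k → r (suc n + k)) 1                      ≡⟨ cong (xorUpTo (λ k → r (suc n + k))) (sym (m+n∸n≡m 1 n)) ⟩
      xorUpTo (λ k → r (suc n + k)) (suc (suc n) ∸ suc n)  ≡⟨ odd-cuts (suc n) ≤-refl odd-1+n true ⟩
      true                                                 ∎
      where
      open ≡-Reasoning
      odd-1+n : odd (suc n) ≡ true
      odd-1+n = trans (cong not (sym (not-involutive (odd n)))) (cong not odd-n)
    pairs : ∀ k → 1 ≤ k → k ≤ (suc (suc n) ∸ 2) / 2 →
      (r (2 * k ∸ 1) ≡ true → r (2 * k) ≡ true) × (r (2 * k) ≡ true → r (2 * k ∸ 1) ≡ true)
    pairs (suc k) _ k≤ = (λ rm → trans (sym same) rm) , (λ rm′ → trans same rm′)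
      where
      m = 2 * suc k ∸ 1
      2k≤n : 2 * suc k ≤ n
      2k≤n = ≤-trans (*-monoʳ-≤ 2 k≤) (subst (_≤ n) (*-comm (n / 2) 2) (m/n*n≤m n 2))
      odd-m : odd m ≡ true
      odd-m = trans (sym (not-involutive (odd m))) (cong not (odd-* 2 (suc k)))
      2+m< : suc (suc m) < suc (suc n)
      2+m< = s≤s (s≤s 2k≤n)
      same : r m ≡ r (suc m)
      same = cancel (r m) (r (suc m)) (begin
        (true xor r m) xor r (suc m)
          ≡⟨ cong (λ x → (x xor r m) xor r (suc m))
               (sym (odd-prefix m (<-trans (<-trans (n<1+n m) (n<1+n (suc m))) 2+m<) odd-m)) ⟩
        (xorUpTo r m xor r m) xor r (suc m)  ≡⟨ cong (_xor r (suc m)) (sym (xorUpTo-suc r m)) ⟩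
        xorUpTo r (suc m) xor r (suc m)      ≡⟨ sym (xorUpTo-suc r (suc m)) ⟩
        xorUpTo r (suc (suc m))              ≡⟨ odd-prefix (suc (suc m)) 2+m< (trans (not-involutive (odd m)) odd-m) ⟩
        true                                 ∎)
        where
        open ≡-Reasoning
        cancel : ∀ x y → (true xor x) xor y ≡ true → x ≡ y
        cancel true true _ = refl
        cancel false false _ = refl

  evenCut? : ∀ n c → Dec (odd c ≡ true × (segmentParity r n c false ≡ false ⊎ segmentParity r n c true ≡ false))
  evenCut? n c = (odd c Bool.≟ true) ×-dec
    ((segmentParity r n c false Bool.≟ false) ⊎-dec (segmentParity r n c true Bool.≟ false))

  evenCut : ∀ n → 1 ≤ n → odd n ≡ false → ¬ BadPath n r →
    ∃[ c ] (odd c ≡ true × c < n × ∃[ h ] segmentParity r n c h ≡ false)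
  evenCut n 1≤n odd-n notBad with anyUpTo? (evenCut? n) n
  ... | yes (c , c<n , odd-c , inj₁ even) = c , odd-c , c<n , false , even
  ... | yes (c , c<n , odd-c , inj₂ even) = c , odd-c , c<n , true , even
  ... | no noCut = ⊥-elim (notBad (badPath-from-odd-cuts n 1≤n odd-n odd-cuts))
    where
    odd-cuts : ∀ c → c < n → odd c ≡ true → ∀ h → segmentParity r n c h ≡ true
    odd-cuts c c<n odd-c false = ¬-not (λ even → noCut (c , c<n , odd-c , inj₁ even))
    odd-cuts c c<n odd-c true = ¬-not (λ even → noCut (c , c<n , odd-c , inj₂ even))

-- Cut off the boundary row q-1 (if w) or 0 (if not w).
boundaryCut : ℕ → Bool → ℕ
boundaryCut q false = 1
boundaryCut q true = q ∸ 1

module _ (q′ : ℕ) (odd-q′ : odd q′ ≡ false) where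

  private
    q = suc (suc q′)

  boundaryCut-positive : ∀ w → 0 < boundaryCut q w
  boundaryCut-positive false = s≤s z≤n
  boundaryCut-positive true = s≤s z≤n

  boundaryCut-< : ∀ w → boundaryCut q w < q
  boundaryCut-< false = s≤s (s≤s z≤n)
  boundaryCut-< true = ≤-refl

  boundaryCut-height : ∀ w → segLength q (boundaryCut q w) w ≡ 1
  boundaryCut-height false = refl
  boundaryCut-height true = m+n∸n≡m 1 q′

  boundaryCut-odd : ∀ w w′ → odd (segLength q (boundaryCut q w) w′) ≡ true
  boundaryCut-odd false false = refl
  boundaryCut-odd false true = cong not odd-q′
  boundaryCut-odd true false = cong not odd-q′
  boundaryCut-odd true true = cong odd (m+n∸n≡m 1 q′)

  blockParity-boundary : ∀ T p a h w →
    blockParity T p q a (boundaryCut q w) h w ≡ segmentParity (rowX T (offset (boundaryCut q w) w)) p a h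
  blockParity-boundary T p a h w = xorUpTo-cong (segLength p a h) (λ k _ → begin
    xorUpTo (λ m → T (offset a h + k , j + m)) (segLength q (boundaryCut q w) w)
      ≡⟨ cong (xorUpTo (λ m → T (offset a h + k , j + m))) (boundaryCut-height w) ⟩
    T (offset a h + k , j + 0) xor false
      ≡⟨ xor-identityʳ _ ⟩
    T (offset a h + k , j + 0)
      ≡⟨ cong (λ j′ → T (offset a h + k , j′)) (+-identityʳ j) ⟩
    T (offset a h + k , j) ∎)
    where
    open ≡-Reasoning
    j = offset (boundaryCut q w) w

cutAtRow : ∀ {p q′ T} → 1 ≤ p → odd p ≡ false → odd q′ ≡ false → gridParity T p (suc (suc q′)) ≡ false →
  ∀ w → ¬ BadPath p (rowX T (offset (boundaryCut (suc (suc q′)) w) w)) → ℤ²Gluing.TOddRanking p (suc (suc q′)) T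
cutAtRow {p} {q′} {T} 1≤p odd-p odd-q′ even w nonBad
  with evenCut (rowX T (offset (boundaryCut (suc (suc q′)) w) w)) p 1≤p odd-p nonBad
... | c , odd-c , c<p , h , even-segment =
  crossRanking (odd⇒positive odd-c) c<p (boundaryCut-positive q′ odd-q′ w) (boundaryCut-< q′ odd-q′ w)
    odd-widths (boundaryCut-odd q′ odd-q′ w) even
    (h , w , trans (blockParity-boundary q′ odd-q′ T p c h w) even-segment)
  where
  odd-widths : ∀ h → odd (segLength p c h) ≡ true
  odd-widths false = odd-c
  odd-widths true = trans (odd-∸ (<⇒≤ c<p)) (cong₂ _xor_ odd-p odd-c)

evenGridRanking : ∀ p q T → 1 ≤ p → 1 ≤ q → odd p ≡ false → odd q ≡ false → gridParity T p q ≡ false →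
  ¬ BadPath p (rowX T 0) ⊎ ¬ BadPath p (rowX T (q ∸ 1)) → ℤ²Gluing.TOddRanking p q T
evenGridRanking p (suc (suc q′)) T 1≤p _ odd-p odd-q even (inj₁ nonBad) =
  cutAtRow 1≤p odd-p (trans (sym (not-involutive (odd q′))) odd-q) even false nonBad
evenGridRanking p (suc (suc q′)) T 1≤p _ odd-p odd-q even (inj₂ nonBad) =
  cutAtRow 1≤p odd-p (trans (sym (not-involutive (odd q′))) odd-q) even true nonBad

lemma7 : (p q : ℕ) → 1 ≤ p → 1 ≤ q → (T : Subset) →
         (numEdges p q + card p q T) % 2 ≡ 0 →
         (¬ BadPath p (rowX T 0) ⊎ ¬ BadPath p (rowX T (q ∸ 1)) ⊎
          ¬ BadPath q (colY T 0) ⊎ ¬ BadPath q (colY T (p ∸ 1))) →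
         ∃[ D ] (IsOrientation p q D × IsTOdd p q T D × IsAcyclic D)
lemma7 p q 1≤p 1≤q T handshake nonBad
  with odd p in odd-p | odd q in odd-q | gridParity-from-handshake p q T 1≤p 1≤q handshake
... | true | _ | total =
  ℤ²Ranking.acyclicTOddOrientation (oddWidthRanking p q T odd-p (trans total (cong not (sym odd-q))))
... | false | true | total =
  ℤ²Ranking.acyclicTOddOrientation (ℤ²Ranking.transpose
    (oddWidthRanking q p (T ∘ swap) odd-q (trans (gridParity-swap T p q) (trans total (cong not (sym odd-p))))))
... | false | false | total with nonBad
...   | inj₁ nonBad-row = ℤ²Gluing.acyclicTOddOrientation
  (evenGridRanking p q T 1≤p 1≤q odd-p odd-q total (inj₁ nonBad-row))
...   | inj₂ (inj₁ nonBad-row) = ℤ²Gluing.acyclicTOddOrientation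
  (evenGridRanking p q T 1≤p 1≤q odd-p odd-q total (inj₂ nonBad-row))
...   | inj₂ (inj₂ (inj₁ nonBad-column)) = ℤ²Gluing.acyclicTOddOrientation (ℤ²Gluing.transpose
  (evenGridRanking q p (T ∘ swap) 1≤q 1≤p odd-q odd-p (trans (gridParity-swap T p q) total) (inj₁ nonBad-column)))
...   | inj₂ (inj₂ (inj₂ nonBad-column)) = ℤ²Gluing.acyclicTOddOrientation (ℤ²Gluing.transpose
  (evenGridRanking q p (T ∘ swap) 1≤q 1≤p odd-q odd-p (trans (gridParity-swap T p q) total) (inj₂ nonBad-column)))
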